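{- Let $\mathcal G=(\mathcal N,\mathcal A,\mathcal R)$ be a first-order grammar, let $\mathcal C$ be a set of pairs of terms with $E\not\sim F$ for all $(E,F)\in\mathcal C$, let $n\in\mathbb N$, let $g:\mathbb N_+\to\mathbb N_+$ be nondecreasing, and let $B\in\mathbb N$ be a sufficient size-bound for $(\mathcal C,n,g)$. Put $\mathrm{Rest}=\mathrm{Size}_{\le B}\setminus\mathcal C$. Then every eqlevel-decreasing $(n,g)$-sequence whose first pair has equivalence level less than $\mathrm{LEqL}(\mathrm{Rest})$ has length at most $\ell^{\mathcal C}_{n,g}$.
   Context: Terms: variables $\mathrm{Var}=\{x_1,x_2,\dots\}$, finite set $\mathcal N$ of nonterminals with arities; terms are rooted ordered (possibly infinite) trees labelled in $\mathcal N\cup\mathrm{Var}$ (variable-nodes are leaves, $A$-nodes have $\mathrm{arity}(A)$ ordered successors); $\mathcal T_{\mathcal N}$ is the set of regular terms. $\mathrm{PresSize}(E)$ is the number of distinct subterms of $E$; $\mathrm{PresSize}(E,F)=\mathrm{PresSize}(E)+\mathrm{PresSize}(F)$. Substitutions $\sigma$ have finite support $\mathrm{supp}(\sigma)$; $E\sigma$ replaces each $x_i$ by $\sigma(x_i)$. First-order grammar $\mathcal G=(\mathcal N,\mathcal A,\mathcal R)$: finite action set, finite set of rules $A(x_1,\dots,x_m)\xrightarrow{a}E$, $m=\mathrm{arity}(A)$, $E$ finite with variables among $x_1,\dots,x_m$. LTS $\mathcal L^{\mathrm{act}}_{\mathcal G}$: states $\mathcal T_{\mathcal N}$, transitions $(A(x_1,\dots,x_m))\tau\xrightarrow{a}E\tau$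 for every rule and substitution $\tau$. $\sim_0$ is total; $T\sim_{k+1}U$ iff each $T\xrightarrow{a}T'$ is matched by some $U\xrightarrow{a}U'$ with $T'\sim_kU'$ and vice versa, with the convention $x_i\not\sim_1H$ for every $H\neq x_i$. $\sim=\bigcap_k\sim_k$, $\mathrm{EqL}(T,U)=\max\{k\in\mathbb N\cup\{\omega\}\mid T\sim_kU\}$. For a set $\mathcal B$ of pairs, $\mathrm{LEqL}(\mathcal B)=\min\{\mathrm{EqL}(E,F)\mid(E,F)\in\mathcal B\}$ (with $\min\emptyset=\omega$) and $\mathrm{MEqL}(\mathcal B)=\max\{\mathrm{EqL}(E,F)\mid(E,F)\in\mathcal B\}$ (with $\max\emptyset=0$). A sequence $(V_1,V'_1),(V_2,V'_2),\dots$ is eqlevel-decreasing if $\omega>\mathrm{EqL}(V_1,V'_1)>\mathrm{EqL}(V_2,V'_2)>\cdots$; it is an $(n,g)$-sequence if it can be written $(E_1\sigma,F_1\sigma),(E_2\sigma,F_2\sigma),\dots$ with one substitution $\sigma$, $|\mathrm{supp}(\sigma)|\le n$, and $\mathrm{PresSize}(E_j,F_j)\le g(j)$ for all $j$. $\mathrm{SInc}=\max\{\mathrm{PresSize}(E)\mid E$ is a right-hand side of a rule in $\mathcal R\}$. $\mathrm{Size}_{\le b}=\{(E,F)\mid\mathrm{PresSize}(E,F)\le b\}$. $\mathrm{MEL}^{\mathcal C}_b=\mathrm{MEqL}(\mathrm{Size}_{\le b}\cap\mathcal C)$. Define recursively $\ell^{\mathcal C}_{0,g}=1+\mathrm{MEL}^{\mathcal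 C}_{g(1)}$ and $\ell^{\mathcal C}_{n+1,g}=1+\mathrm{MEL}^{\mathcal C}_{g(1)}+\ell^{\mathcal C}_{n,g'}$, where $g'(j)=g(1+\mathrm{MEL}^{\mathcal C}_{g(1)}+j)+2\cdot(g(1)+\mathrm{MEL}^{\mathcal C}_{g(1)}\cdot\mathrm{SInc})$ for $j\in\mathbb N_+$. $B$ is a sufficient size-bound for $(\mathcal C,n,g)$ if $\mathcal C\subseteq\mathrm{Size}_{\le B}$, $g(1)\le B$, and, when $n>0$, $B$ is a sufficient size-bound for $(\mathcal C,n-1,g')$ with $g'$ as just defined. -}

module Defs where

open import Data.Nat using (ℕ; zero; suc; _+_; _*_; _≤_; _<_; _<?_)
open import Data.Fin using (Fin; toℕ; fromℕ<)
open import Data.Vec using (Vec; []; _∷_)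
open import Data.List using (List; []; _∷_; length)
open import Data.List.Membership.Propositional using (_∈_)
open import Data.List.Relation.Unary.All using (All)
open import Data.List.Relation.Unary.Any using (Any)
open import Data.List.Relation.Unary.AllPairs using (AllPairs)
open import Data.Product using (Σ; ∃; _×_; _,_)
open import Data.Sum using (_⊎_)
open import Data.Unit using (⊤)
open import Relation.Nullary using (¬_; yes; no)
open import Relation.Binary.PropositionalEquality using (_≡_)

-- Variables x_i are indexed by ℕ (x_i is  var i ; 0-based).
-- A (possibly infinite) rooted ordered tree is represented by its
-- labelling of positions: a position is a finite path  k₁ ∷ k₂ ∷ … ∷ []
-- (go to the k₁-th successor, then the k₂-th, …; successors 0-based),
-- and positions that are not in the tree are labelled  none .
-- Equality of trees is pointwise equality of labellings ( _≈_ ).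

module Terms (nN : ℕ) (arity : Fin nN → ℕ) where

  data Label : Set where
    var  : ℕ → Label
    nt   : Fin nN → Label
    none : Label

  Tree : Set
  Tree = List ℕ → Label

  _≈_ : Tree → Tree → Set
  T ≈ U = ∀ p → T p ≡ U p

  child : Tree → ℕ → Tree
  child T k q = T (k ∷ q)

  sub : Tree → List ℕ → Tree
  sub T []      = T
  sub T (k ∷ p) = sub (child T k) p

  LocalOK : Tree → Set
  LocalOK T with T []
  ... | var i = ∀ k → T (k ∷ []) ≡ none
  ... | none  = ∀ k → T (k ∷ []) ≡ none
  ... | nt A  = ∀ k → (k < arity A → ¬ (T (k ∷ []) ≡ none)) ×
                      (arity A ≤ k → T (k ∷ []) ≡ none)

  WF : Tree → Set
  WF T = ¬ (T [] ≡ none) × (∀ p → LocalOK (sub T p))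

  V : ℕ → Tree
  V i []      = var i
  V i (_ ∷ _) = none

  _⊑_ : Tree → Tree → Set
  U ⊑ T = Σ (List ℕ) λ p → ¬ (T p ≡ none) × U ≈ sub T p

  HasPresSize : Tree → ℕ → Set
  HasPresSize T k =
    Σ (List Tree) λ L →
      length L ≡ k ×
      All (λ U → U ⊑ T) L ×
      AllPairs (λ U U' → ¬ (U ≈ U')) L ×
      (∀ U → U ⊑ T → Any (λ U' → U ≈ U') L)

  -- T ∈ T_N : a (well-formed) regular term
  IsTerm : Tree → Set
  IsTerm T = WF T × ∃ λ k → HasPresSize T k

  PairSizeLe : Tree → Tree → ℕ → Set
  PairSizeLe E F b = WF E × WF F × ∃ λ k₁ → ∃ λ k₂ →
    HasPresSize E k₁ × HasPresSize F k₂ × k₁ + k₂ ≤ b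

  subst : Tree → (ℕ → Tree) → Tree
  subst T σ p with T []
  subst T σ p       | var i = σ i p
  subst T σ []      | l     = l
  subst T σ (k ∷ p) | nt A  = subst (child T k) σ p
  subst T σ (k ∷ p) | none  = none

  SuppAtMost : (ℕ → Tree) → ℕ → Set
  SuppAtMost σ n = Σ (List ℕ) λ xs → length xs ≤ n ×
    (∀ i → ¬ (i ∈ xs) → σ i ≈ V i)

  -- finite terms with variables in a set X (right-hand sides of rules)
  data FTerm (X : Set) : Set where
    fvar  : X → FTerm X
    fnode : (A : Fin nN) → Vec (FTerm X) (arity A) → FTerm X

  mutual
    embed : ∀ {m} → FTerm (Fin m) → Tree
    embed (fvar k)    []      = var (toℕ k)
    embed (fvar k)    (_ ∷ _) = none
    embed (fnode A us) []      = nt A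
    embed (fnode A us) (k ∷ p) = embedV us k p

    embedV : ∀ {m n} → Vec (FTerm (Fin m)) n → ℕ → List ℕ → Label
    embedV []       _       _ = none
    embedV (u ∷ us) zero    p = embed u p
    embedV (u ∷ us) (suc k) p = embedV us k p

record Rule (nN : ℕ) (arity : Fin nN → ℕ) (nA : ℕ) : Set where
  field
    head : Fin nN
    act  : Fin nA
    rhs  : Terms.FTerm nN arity (Fin (arity head))

record Grammar : Set where
  field
    nN     : ℕ
    arity  : Fin nN → ℕ
    nA     : ℕ
    rules  : List (Rule nN arity nA)

data ℕω : Set where
  fin : ℕ → ℕω
  ω   : ℕω

module FOG (G : Grammar) where
  open Grammar G public
  open Terms nN arity public
  open Rule public

  -- transitions of the LTS  L^act_G :  (A(x_0..x_{m-1}))τ --a--> Eτ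
  Step : Tree → Fin nA → Tree → Set
  -- (the root of T is  head r ; τ(x_k) = k-th successor subtree of T;
  --  the values of τ outside x_0..x_{m-1} do not affect  rhs r τ )
  Step T a T' = Σ (Rule nN arity nA) λ r → r ∈ rules × act r ≡ a ×
    T [] ≡ nt (head r) × T' ≈ subst (embed (rhs r)) (child T)

  -- convention  x_i ≁_1 H  for every H ≠ x_i
  VarCond : Tree → Tree → Set
  VarCond T U = (∀ i → T ≈ V i → U ≈ V i) × (∀ i → U ≈ V i → T ≈ V i)

  _∼⟨_⟩_ : Tree → ℕ → Tree → Set
  T ∼⟨ zero ⟩ U = ⊤
  T ∼⟨ suc k ⟩ U = VarCond T U ×
    (∀ a T' → Step T a T' → ∃ λ U' → Step U a U' × T' ∼⟨ k ⟩ U') ×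
    (∀ a U' → Step U a U' → ∃ λ T' → Step T a T' × T' ∼⟨ k ⟩ U')

  _∼_ : Tree → Tree → Set
  T ∼ U = ∀ k → T ∼⟨ k ⟩ U

  EqLIs : Tree → Tree → ℕω → Set
  EqLIs T U (fin e) = T ∼⟨ e ⟩ U × (∀ k → T ∼⟨ k ⟩ U → k ≤ e)
  EqLIs T U ω       = T ∼ U

  EqLAbove : ℕ → Tree → Tree → Set
  EqLAbove e T U = ∃ λ k → e < k × T ∼⟨ k ⟩ U

  PairSet : Set₁
  PairSet = Tree → Tree → Set

  Size≤ : ℕ → PairSet
  Size≤ b E F = PairSizeLe E F b

  Rest : PairSet → ℕ → PairSet
  Rest C B E F = Size≤ B E F × ¬ C E F

  -- e < LEqL(R)   (LEqL(R) = min of EqL over R, min ∅ = ω)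
  BelowLEqL : ℕ → PairSet → Set
  BelowLEqL e R = ∀ E F → R E F → EqLAbove e E F

  -- m = MEL^C_b = MEqL(Size_{≤b} ∩ C)   (max over the set, max ∅ = 0)
  IsMEL : PairSet → ℕ → ℕ → Set
  IsMEL C b m =
    (∀ E F → Size≤ b E F → C E F → ∀ k → E ∼⟨ k ⟩ F → k ≤ m) ×
    ((∃ λ E → ∃ λ F → Size≤ b E F × C E F × EqLIs E F (fin m)) ⊎
     (m ≡ 0 × (∀ E F → Size≤ b E F → ¬ C E F)))

  -- s = SInc = max PresSize of right-hand sides of rules  (max ∅ = 0)
  IsSInc : ℕ → Set
  IsSInc s =
    (∀ r → r ∈ rules → ∀ k → HasPresSize (embed (rhs r)) k → k ≤ s) ×
    ((∃ λ r → r ∈ rules × HasPresSize (embed (rhs r)) s) ⊎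
     (rules ≡ [] × s ≡ 0))

  -- functions  g : ℕ₊ → ℕ₊  are represented as  ℕ → ℕ  (value at 0 ignored)
  Positive : (ℕ → ℕ) → Set
  Positive g = ∀ j → 1 ≤ j → 1 ≤ g j

  Nondecreasing : (ℕ → ℕ) → Set
  Nondecreasing g = ∀ i j → 1 ≤ i → i ≤ j → g i ≤ g j

  gPrime : (mel : ℕ → ℕ) (sinc : ℕ) → (ℕ → ℕ) → ℕ → ℕ
  gPrime mel sinc g j =
    g (1 + mel (g 1) + j) + 2 * (g 1 + mel (g 1) * sinc)

  ell : (mel : ℕ → ℕ) (sinc : ℕ) → ℕ → (ℕ → ℕ) → ℕ
  ell mel sinc zero    g = 1 + mel (g 1)
  ell mel sinc (suc n) g = 1 + mel (g 1) + ell mel sinc n (gPrime mel sinc g)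

  SufficientSizeBound : PairSet → (mel : ℕ → ℕ) (sinc : ℕ) →
                        ℕ → (ℕ → ℕ) → ℕ → Set
  SufficientSizeBound C mel sinc zero g B =
    (∀ E F → C E F → Size≤ B E F) × g 1 ≤ B
  SufficientSizeBound C mel sinc (suc n) g B =
    (∀ E F → C E F → Size≤ B E F) × g 1 ≤ B ×
    SufficientSizeBound C mel sinc n (gPrime mel sinc g) B

  EqlevelDecreasing : ℕ → (ℕ → Tree) → (ℕ → Tree) → Set
  EqlevelDecreasing L W W' = Σ (ℕ → ℕ) λ e →
    (∀ j → 1 ≤ j → j ≤ L → EqLIs (W j) (W' j) (fin (e j))) ×
    (∀ j → 1 ≤ j → j < L → e (suc j) < e j)

  NGSequence : ℕ → (ℕ → ℕ) → ℕ → (ℕ → Tree) → (ℕ → Tree) → Set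
  NGSequence n g L W W' =
    Σ (ℕ → Tree) λ σ → Σ (ℕ → Tree) λ E → Σ (ℕ → Tree) λ F →
      SuppAtMost σ n × (∀ i → IsTerm (σ i)) ×
      (∀ j → 1 ≤ j → j ≤ L →
        W j ≈ subst (E j) σ × W' j ≈ subst (F j) σ ×
        PairSizeLe (E j) (F j) (g j))

  -- C is a set of pairs of trees: closed under tree equality
  RespectsTreeEq : PairSet → Set
  RespectsTreeEq C = ∀ E F E' F' → E ≈ E' → F ≈ F' → C E F → C E' F'

-- Let (E_jσ, F_jσ), j = 1..L, have levels e₁ > e₂ > … and put M = MEL^C_{g(1)}.
-- Strict decrease gives L ≤ e₁ + 1, so only L > 1 + M needs an argument, and
-- then e₁ > M.  Substitution preserves ∼ₖ, so (E₁,F₁) ∉ Rest; it lies in C,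
-- whence E₁ ≁_{M+1} F₁.  Playing the bisimulation game on E₁, F₁ for M+1 rounds
-- (decomposition) yields a variable x_i of the support of σ and a term H ≠ x_i
-- reached within M steps with σ(x_i) ∼_{e₁-M} Hσ.  Replacing x_i by the regular
-- term Hω = H[x_i ≔ Hω] and removing x_i from σ keeps every later pair at its
-- level (all are below e₁ - M) and adds at most 2·PresSize(H) to sizes, so the
-- pairs after position 1 + M form an (n-1, g')-sequence; induction on n gives
-- L ≤ 1 + M + ℓ_{n-1,g'}.

module Submission where

open import Defs
open import Data.Nat using (ℕ; zero; suc; _+_; _*_; _∸_; _≤_; _<_; _≤′_; ≤′-refl; ≤′-step; _≟_; _≤?_; z≤n; s≤s)
open import Data.Nat.Properties
open import Data.Nat.Solver using (module +-*-Solver)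
open +-*-Solver using (solve; _:+_; _:*_; _:=_; con)
open import Data.Fin using (Fin; toℕ)
open import Data.Fin.Properties using (toℕ<n)
open import Data.Vec using (Vec; []; _∷_)
open import Data.List using (List; []; _∷_; length; _++_; map; filter)
open import Data.List.Properties using (length-++; length-map; filter-notAll)
open import Data.List.Relation.Unary.Any as Any using (Any; here; there)
import Data.List.Relation.Unary.Any.Properties as Anyₚ
open import Data.List.Relation.Unary.All using (All; []; _∷_)
import Data.List.Relation.Unary.All.Properties as Allₚ
open import Data.List.Relation.Unary.AllPairs using (AllPairs; []; _∷_)
open import Data.List.Membership.Propositional using (_∈_)
open import Data.List.Membership.Propositional.Properties using (∈-filter⁺)
open import Data.List.Membership.DecPropositional _≟_ using (_∈?_)
open import Data.Product using (Σ; _×_; _,_; proj₁; proj₂)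
open import Data.Sum using (_⊎_; inj₁; inj₂)
open import Data.Empty using (⊥; ⊥-elim)
open import Data.Unit using (⊤; tt)
open import Function using (_∘_)
open import Effect.Monad using (RawMonad)
import Level
open import Relation.Nullary using (¬_; ¬?; yes; no; Dec)
open import Relation.Nullary.Decidable using (decidable-stable)
open import Relation.Nullary.Negation using (¬¬-Monad; DoubleNegation)
open import Relation.Nullary.Decidable.Core using (¬¬-excluded-middle)
open import Relation.Binary.PropositionalEquality as Eq using (_≡_; refl; sym; trans; cong)

module Theory (G : Grammar) where
  open FOG G

  ≈-refl : ∀ {T} → T ≈ T
  ≈-refl _ = refl

  ≈-sym : ∀ {T U} → T ≈ U → U ≈ T
  ≈-sym e p = sym (e p)

  ≈-trans : ∀ {T U W} → T ≈ U → U ≈ W → T ≈ W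
  ≈-trans e f p = trans (e p) (f p)

  -- The tree with no nodes at all; substitution sends a `none` root to it.
  Void : Tree
  Void _ = none

  data RootView (T : Tree) : Set where
    root-var  : ∀ j → T [] ≡ var j → RootView T
    root-nt   : ∀ A → T [] ≡ nt A → RootView T
    root-none : T [] ≡ none → RootView T

  rootView : ∀ T → RootView T
  rootView T with T [] in eq
  ... | var j = root-var j eq
  ... | nt A  = root-nt A eq
  ... | none  = root-none eq

  subst-var : ∀ T σ j → T [] ≡ var j → subst T σ ≈ σ j
  subst-var T σ j eq p rewrite eq = refl

  subst-none : ∀ T σ → T [] ≡ none → subst T σ ≈ Void
  subst-none T σ eq []      rewrite eq = refl
  subst-none T σ eq (k ∷ p) rewrite eq = refl

  subst-root : ∀ T σ A → T [] ≡ nt A → subst T σ [] ≡ nt A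
  subst-root T σ A eq rewrite eq = refl

  subst-child : ∀ T σ A → T [] ≡ nt A → ∀ k → child (subst T σ) k ≈ subst (child T k) σ
  subst-child T σ A eq k p rewrite eq = refl

  subst-congˡ : ∀ T T' σ → T ≈ T' → subst T σ ≈ subst T' σ
  subst-congˡ T T' σ e p with rootView T
  ... | root-var j eq = trans (subst-var T σ j eq p) (sym (subst-var T' σ j (trans (sym (e [])) eq) p))
  ... | root-none eq  = trans (subst-none T σ eq p) (sym (subst-none T' σ (trans (sym (e [])) eq) p))
  subst-congˡ T T' σ e [] | root-nt A eq =
    trans (subst-root T σ A eq) (sym (subst-root T' σ A (trans (sym (e [])) eq)))
  subst-congˡ T T' σ e (k ∷ p) | root-nt A eq =
    trans (subst-child T σ A eq k p)
      (trans (subst-congˡ (child T k) (child T' k) σ (λ q → e (k ∷ q)) p)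
        (sym (subst-child T' σ A (trans (sym (e [])) eq) k p)))

  subst-congʳ : ∀ T σ σ' → (∀ j → σ j ≈ σ' j) → subst T σ ≈ subst T σ'
  subst-congʳ T σ σ' e p with rootView T
  ... | root-var j eq = trans (subst-var T σ j eq p) (trans (e j p) (sym (subst-var T σ' j eq p)))
  ... | root-none eq  = trans (subst-none T σ eq p) (sym (subst-none T σ' eq p))
  subst-congʳ T σ σ' e [] | root-nt A eq = trans (subst-root T σ A eq) (sym (subst-root T σ' A eq))
  subst-congʳ T σ σ' e (k ∷ p) | root-nt A eq =
    trans (subst-child T σ A eq k p) (trans (subst-congʳ (child T k) σ σ' e p) (sym (subst-child T σ' A eq k p)))

  subst-subst : ∀ T τ σ → subst (subst T τ) σ ≈ subst T (λ j → subst (τ j) σ)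
  subst-subst T τ σ p with rootView T
  ... | root-var j eq =
    trans (subst-congˡ (subst T τ) (τ j) σ (subst-var T τ j eq) p) (sym (subst-var T _ j eq p))
  ... | root-none eq =
    trans (subst-congˡ (subst T τ) Void σ (subst-none T τ eq) p)
      (trans (subst-none Void σ refl p) (sym (subst-none T _ eq p)))
  subst-subst T τ σ [] | root-nt A eq =
    trans (subst-root (subst T τ) σ A (subst-root T τ A eq)) (sym (subst-root T _ A eq))
  subst-subst T τ σ (k ∷ p) | root-nt A eq =
    trans (subst-child (subst T τ) σ A (subst-root T τ A eq) k p)
      (trans (subst-congˡ (child (subst T τ) k) (subst (child T k) τ) σ (subst-child T τ A eq k) p)
        (trans (subst-subst (child T k) τ σ p) (sym (subst-child T _ A eq k p))))

  sub-++ : ∀ T q r → sub T q r ≡ T (q ++ r)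
  sub-++ T []      r = refl
  sub-++ T (k ∷ q) r = sub-++ (child T k) q r

  sub-root : ∀ T q → sub T q [] ≡ T q
  sub-root T []      = refl
  sub-root T (k ∷ q) = sub-root (child T k) q

  sub-cong : ∀ T T' q → T ≈ T' → sub T q ≈ sub T' q
  sub-cong T T' q e r = trans (sub-++ T q r) (trans (e (q ++ r)) (sym (sub-++ T' q r)))

  step-respˡ : ∀ {T T' a X} → T ≈ T' → Step T a X → Step T' a X
  step-respˡ {T} {T'} e (r , r∈ , act≡ , head≡ , X≈) =
    r , r∈ , act≡ , trans (sym (e [])) head≡ ,
    ≈-trans X≈ (subst-congʳ (embed (rhs r)) (child T) (child T') (λ k q → e (k ∷ q)))

  ∼-respˡ : ∀ k {T T' U} → T ≈ T' → T ∼⟨ k ⟩ U → T' ∼⟨ k ⟩ U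
  ∼-respˡ zero    e s = tt
  ∼-respˡ (suc k) e ((v₁ , v₂) , fwd , bwd) =
    ((λ i x → v₁ i (≈-trans e x)) , (λ i x → ≈-trans (≈-sym e) (v₂ i x))) ,
    (λ a X st → fwd a X (step-respˡ (≈-sym e) st)) ,
    (λ a U' st → let (X , st' , s) = bwd a U' st in X , step-respˡ e st' , s)

  ∼-sym : ∀ k {T U} → T ∼⟨ k ⟩ U → U ∼⟨ k ⟩ T
  ∼-sym zero    s = tt
  ∼-sym (suc k) ((v₁ , v₂) , fwd , bwd) = (v₂ , v₁) ,
    (λ a X st → let (Y , st' , s) = bwd a X st in Y , st' , ∼-sym k s) ,
    (λ a X st → let (Y , st' , s) = fwd a X st in Y , st' , ∼-sym k s)

  ∼-respʳ : ∀ k {T U U'} → U ≈ U' → T ∼⟨ k ⟩ U → T ∼⟨ k ⟩ U'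
  ∼-respʳ k e s = ∼-sym k (∼-respˡ k e (∼-sym k s))

  ∼-refl : ∀ k {T} → T ∼⟨ k ⟩ T
  ∼-refl zero    = tt
  ∼-refl (suc k) = ((λ i x → x) , (λ i x → x)) ,
    (λ a X st → X , st , ∼-refl k) , (λ a X st → X , st , ∼-refl k)

  ≈⇒∼ : ∀ k {T U} → T ≈ U → T ∼⟨ k ⟩ U
  ≈⇒∼ k e = ∼-respʳ k e (∼-refl k)

  ∼-trans : ∀ k {T U W} → T ∼⟨ k ⟩ U → U ∼⟨ k ⟩ W → T ∼⟨ k ⟩ W
  ∼-trans zero    s t = tt
  ∼-trans (suc k) ((v₁ , v₂) , fwd , bwd) ((w₁ , w₂) , fwd' , bwd') =
    ((λ i x → w₁ i (v₁ i x)) , (λ i x → v₂ i (w₂ i x))) ,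
    (λ a X st → let (Y , st' , s) = fwd a X st ; (Z , st'' , t) = fwd' a Y st' in Z , st'' , ∼-trans k s t) ,
    (λ a X st → let (Y , st' , s) = bwd' a X st ; (Z , st'' , t) = bwd a Y st' in Z , st'' , ∼-trans k t s)

  ∼-pred : ∀ k {T U} → T ∼⟨ suc k ⟩ U → T ∼⟨ k ⟩ U
  ∼-pred zero    s = tt
  ∼-pred (suc k) (v , fwd , bwd) = v ,
    (λ a X st → let (Y , st' , s) = fwd a X st in Y , st' , ∼-pred k s) ,
    (λ a X st → let (Y , st' , s) = bwd a X st in Y , st' , ∼-pred k s)

  ∼-mono : ∀ {k k' T U} → k ≤ k' → T ∼⟨ k' ⟩ U → T ∼⟨ k ⟩ U
  ∼-mono le = mono′ (≤⇒≤′ le)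
    where
    mono′ : ∀ {k k' T U} → k ≤′ k' → T ∼⟨ k' ⟩ U → T ∼⟨ k ⟩ U
    mono′ ≤′-refl        s = s
    mono′ (≤′-step le′) s = mono′ le′ (∼-pred _ s)

  step-subst : ∀ {T a X} σ → Step T a X → Step (subst T σ) a (subst X σ)
  step-subst {T} {a} {X} σ (r , r∈ , act≡ , head≡ , X≈) =
    r , r∈ , act≡ , subst-root T σ (head r) head≡ ,
    ≈-trans (subst-congˡ X (subst (embed (rhs r)) (child T)) σ X≈)
      (≈-trans (subst-subst (embed (rhs r)) (child T) σ)
        (subst-congʳ (embed (rhs r)) _ (child (subst T σ))
          (λ j → ≈-sym (subst-child T σ (head r) head≡ j))))

  step-unsubst : ∀ {T a X} σ {A} → T [] ≡ nt A → Step (subst T σ) a X →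
                 Σ Tree λ X' → Step T a X' × X ≈ subst X' σ
  step-unsubst {T} σ {A} root≡ (r , r∈ , act≡ , head≡ , X≈) =
    subst (embed (rhs r)) (child T) , (r , r∈ , act≡ , head≡' , ≈-refl) ,
    ≈-trans X≈
      (≈-trans (subst-congʳ (embed (rhs r)) (child (subst T σ)) _ (subst-child T σ (head r) head≡'))
        (≈-sym (subst-subst (embed (rhs r)) (child T) σ)))
    where
    head≡' : T [] ≡ nt (head r)
    head≡' = trans root≡ (trans (sym (subst-root T σ A root≡)) head≡)

  nt≢var : ∀ {A i} → nt A ≡ var i → ⊥
  nt≢var ()

  var-injective : ∀ {a b} → var a ≡ var b → a ≡ b
  var-injective refl = refl

  ∼-subst-nt : ∀ k T ρ ρ' A → T [] ≡ nt A → (∀ X' → subst X' ρ ∼⟨ k ⟩ subst X' ρ') →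
               subst T ρ ∼⟨ suc k ⟩ subst T ρ'
  ∼-subst-nt k T ρ ρ' A root≡ h =
    ((λ i x → ⊥-elim (nt≢var (trans (sym (subst-root T ρ A root≡)) (x [])))) ,
     (λ i x → ⊥-elim (nt≢var (trans (sym (subst-root T ρ' A root≡)) (x []))))) ,
    (λ a X st → let (X' , st' , e) = step-unsubst {T} ρ root≡ st in
       subst X' ρ' , step-subst {T} ρ' st' , ∼-respˡ k (≈-sym e) (h X')) ,
    (λ a X st → let (X' , st' , e) = step-unsubst {T} ρ' root≡ st in
       subst X' ρ , step-subst {T} ρ st' , ∼-respʳ k (≈-sym e) (h X'))

  ∼-congʳ : ∀ k T ρ ρ' → (∀ j → ρ j ∼⟨ k ⟩ ρ' j) → subst T ρ ∼⟨ k ⟩ subst T ρ'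
  ∼-congʳ zero    T ρ ρ' h = tt
  ∼-congʳ (suc k) T ρ ρ' h with rootView T
  ... | root-var j eq =
    ∼-respˡ (suc k) (≈-sym (subst-var T ρ j eq)) (∼-respʳ (suc k) (≈-sym (subst-var T ρ' j eq)) (h j))
  ... | root-none eq =
    ∼-respˡ (suc k) (≈-sym (subst-none T ρ eq)) (≈⇒∼ (suc k) (≈-sym (subst-none T ρ' eq)))
  ... | root-nt A eq = ∼-subst-nt k T ρ ρ' A eq (λ X' → ∼-congʳ k X' ρ ρ' (λ j → ∼-pred k (h j)))

  ∼-congʳ-except : ∀ k T i ρ ρ' → ¬ (T [] ≡ var i) → ρ i ∼⟨ k ⟩ ρ' i →
                   (∀ j → ¬ (j ≡ i) → ρ j ∼⟨ suc k ⟩ ρ' j) → subst T ρ ∼⟨ suc k ⟩ subst T ρ'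
  ∼-congʳ-except k T i ρ ρ' T≢xᵢ hᵢ h with rootView T
  ... | root-var j eq =
    ∼-respˡ (suc k) (≈-sym (subst-var T ρ j eq))
      (∼-respʳ (suc k) (≈-sym (subst-var T ρ' j eq)) (h j (λ j≡i → T≢xᵢ (trans eq (cong var j≡i)))))
  ... | root-none eq =
    ∼-respˡ (suc k) (≈-sym (subst-none T ρ eq)) (≈⇒∼ (suc k) (≈-sym (subst-none T ρ' eq)))
  ... | root-nt A eq = ∼-subst-nt k T ρ ρ' A eq (λ X' → ∼-congʳ k X' ρ ρ' pointwise)
    where
    pointwise : ∀ j → ρ j ∼⟨ k ⟩ ρ' j
    pointwise j with j ≟ i
    ... | yes refl = hᵢ
    ... | no j≢i   = ∼-pred k (h j j≢i)

  var≢none : ∀ {j} → var j ≡ none → ⊥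
  var≢none ()

  nt≢none : ∀ {A} → nt A ≡ none → ⊥
  nt≢none ()

  LocalFor : Label → Tree → Set
  LocalFor (nt A) T = ∀ k → (k < arity A → ¬ (T (k ∷ []) ≡ none)) × (arity A ≤ k → T (k ∷ []) ≡ none)
  LocalFor _      T = ∀ k → T (k ∷ []) ≡ none

  local-elim : ∀ {T l} → T [] ≡ l → LocalOK T → LocalFor l T
  local-elim {T} eq lo with T [] | eq | lo
  ... | var i | refl | lo' = lo'
  ... | nt A  | refl | lo' = lo'
  ... | none  | refl | lo' = lo'

  local-intro : ∀ {T l} → T [] ≡ l → LocalFor l T → LocalOK T
  local-intro {T} eq h with T [] | eq
  ... | var i | refl = h
  ... | nt A  | refl = h
  ... | none  | refl = h

  local-resp : ∀ {T T'} → T ≈ T' → LocalOK T → LocalOK T'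
  local-resp {T} {T'} e lo with rootView T
  ... | root-var j eq =
    local-intro (trans (sym (e [])) eq) (λ k → trans (sym (e (k ∷ []))) (local-elim eq lo k))
  ... | root-none eq =
    local-intro (trans (sym (e [])) eq) (λ k → trans (sym (e (k ∷ []))) (local-elim eq lo k))
  ... | root-nt A eq = local-intro (trans (sym (e [])) eq) λ k →
    (λ lt z → proj₁ (local-elim eq lo k) lt (trans (e (k ∷ [])) z)) ,
    (λ ge → trans (sym (e (k ∷ []))) (proj₂ (local-elim eq lo k) ge))

  Void-local : LocalOK Void
  Void-local = local-intro {Void} {none} refl (λ _ → refl)

  wf-resp : ∀ {X X'} → X ≈ X' → WF X' → WF X
  wf-resp {X} {X'} e (root≢none , lo) =
    (λ z → root≢none (trans (sym (e [])) z)) , (λ q → local-resp (sub-cong X' X q (≈-sym e)) (lo q))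

  below-leaf : ∀ S → (∀ p → LocalOK (sub S p)) → LocalFor none S → ∀ k q → S (k ∷ q) ≡ none
  below-leaf S lo leaf k []       = leaf k
  below-leaf S lo leaf k (k' ∷ q) =
    below-leaf (child S k) (λ p → lo (k ∷ p)) (local-elim (leaf k) (lo (k ∷ []))) k' q

  wf-var : ∀ {T i} → WF T → T [] ≡ var i → T ≈ V i
  wf-var (_ , lo) eq []      = eq
  wf-var {T} (_ , lo) eq (k ∷ q) = below-leaf T lo (local-elim eq (lo [])) k q

  wf-V : ∀ i → WF (V i)
  wf-V i = (λ ()) , local
    where
    local : ∀ p → LocalOK (sub (V i) p)
    local []      = local-intro {V i} refl (λ k → refl)
    local (k ∷ p) = local-resp (λ q → sym (sub-++ (child (V i) k) p q)) Void-local

  data PositionView (T : Tree) (ρ : ℕ → Tree) (q : List ℕ) : Set where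
    at-nt    : ∀ A → T q ≡ nt A → sub (subst T ρ) q ≈ subst (sub T q) ρ → PositionView T ρ q
    in-var   : ∀ p q' j → q ≡ p ++ q' → T p ≡ var j → sub (subst T ρ) q ≈ sub (ρ j) q' → PositionView T ρ q
    in-empty : sub (subst T ρ) q ≈ Void → PositionView T ρ q

  positionView : ∀ T ρ q → PositionView T ρ q
  positionView T ρ q with rootView T
  ... | root-var j eq = in-var [] q j refl eq
    (λ r → trans (sub-++ (subst T ρ) q r) (trans (subst-var T ρ j eq (q ++ r)) (sym (sub-++ (ρ j) q r))))
  ... | root-none eq = in-empty (λ r → trans (sub-++ (subst T ρ) q r) (subst-none T ρ eq (q ++ r)))
  positionView T ρ []      | root-nt A eq = at-nt A eq ≈-refl
  positionView T ρ (k ∷ q) | root-nt A eq = descend (positionView (child T k) ρ q)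
    where
    shift : sub (child (subst T ρ) k) q ≈ sub (subst (child T k) ρ) q
    shift = sub-cong (child (subst T ρ) k) (subst (child T k) ρ) q (subst-child T ρ A eq k)
    descend : PositionView (child T k) ρ q → PositionView T ρ (k ∷ q)
    descend (at-nt A' e h)          = at-nt A' e (≈-trans shift h)
    descend (in-var p q' j e₁ e₂ h) = in-var (k ∷ p) q' j (cong (k ∷_) e₁) e₂ (≈-trans shift h)
    descend (in-empty h)            = in-empty (≈-trans shift h)

  local-subst-nt : ∀ S ρ A → S [] ≡ nt A → LocalOK S →
                   (∀ k j → S (k ∷ []) ≡ var j → ¬ (ρ j [] ≡ none)) → LocalOK (subst S ρ)
  local-subst-nt S ρ A root≡ lo ρ-ok = local-intro (subst-root S ρ A root≡) successor
    where
    successor : ∀ k → (k < arity A → ¬ (subst S ρ (k ∷ []) ≡ none)) × (arity A ≤ k → subst S ρ (k ∷ []) ≡ none)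
    successor k with rootView (child S k)
    ... | root-var j e =
      (λ lt z → ρ-ok k j e (trans (sym (subst-var (child S k) ρ j e [])) (trans (sym (subst-child S ρ A root≡ k [])) z))) ,
      (λ ge → ⊥-elim (var≢none (trans (sym e) (proj₂ (local-elim root≡ lo k) ge))))
    ... | root-nt B e =
      (λ lt z → nt≢none (trans (sym (subst-root (child S k) ρ B e)) (trans (sym (subst-child S ρ A root≡ k [])) z))) ,
      (λ ge → ⊥-elim (nt≢none (trans (sym e) (proj₂ (local-elim root≡ lo k) ge))))
    ... | root-none e =
      (λ lt z → proj₁ (local-elim root≡ lo k) lt e) ,
      (λ ge → trans (subst-child S ρ A root≡ k []) (subst-none (child S k) ρ e []))

  wf-subst : ∀ T ρ → ¬ (T [] ≡ none) → (∀ q A → T q ≡ nt A → LocalOK (sub T q)) →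
             (∀ p j → T p ≡ var j → WF (ρ j)) → WF (subst T ρ)
  wf-subst T ρ T≢none T-local ρ-wf = root , local
    where
    root : ¬ (subst T ρ [] ≡ none)
    root with rootView T
    ... | root-var j eq = λ z → proj₁ (ρ-wf [] j eq) (trans (sym (subst-var T ρ j eq [])) z)
    ... | root-nt A eq  = λ z → nt≢none (trans (sym (subst-root T ρ A eq)) z)
    ... | root-none eq  = ⊥-elim (T≢none eq)
    local : ∀ q → LocalOK (sub (subst T ρ) q)
    local q with positionView T ρ q
    ... | at-nt A e h = local-resp (≈-sym h)
      (local-subst-nt (sub T q) ρ A (trans (sub-root T q) e) (T-local q A e)
        (λ k j e' → proj₁ (ρ-wf (q ++ k ∷ []) j (trans (sym (sub-++ T q (k ∷ []))) e'))))
    ... | in-var p q' j _ e h = local-resp (≈-sym h) (proj₂ (ρ-wf p j e) q')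
    ... | in-empty h          = local-resp (≈-sym h) Void-local

  mutual
    embed-var< : ∀ {m} (R : FTerm (Fin m)) p j → embed R p ≡ var j → j < m
    embed-var< (fvar f)     []      j refl = toℕ<n f
    embed-var< (fvar f)     (k ∷ p) j ()
    embed-var< (fnode A us) []      j ()
    embed-var< (fnode A us) (k ∷ p) j e = embedV-var< us k p j e

    embedV-var< : ∀ {m n} (us : Vec (FTerm (Fin m)) n) k p j → embedV us k p ≡ var j → j < m
    embedV-var< []       k       p j ()
    embedV-var< (u ∷ us) zero    p j e = embed-var< u p j e
    embedV-var< (u ∷ us) (suc k) p j e = embedV-var< us k p j e

  embed-root : ∀ {m} (R : FTerm (Fin m)) → ¬ (embed R [] ≡ none)
  embed-root (fvar f)     ()
  embed-root (fnode A us) ()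

  embedV-root : ∀ {m n} (us : Vec (FTerm (Fin m)) n) k → k < n → ¬ (embedV us k [] ≡ none)
  embedV-root (u ∷ us) zero    lt       = embed-root u
  embedV-root (u ∷ us) (suc k) (s≤s lt) = embedV-root us k lt

  embedV-beyond : ∀ {m n} (us : Vec (FTerm (Fin m)) n) k → n ≤ k → ∀ p → embedV us k p ≡ none
  embedV-beyond []       k       le       p = refl
  embedV-beyond (u ∷ us) (suc k) (s≤s le) p = embedV-beyond us k le p

  mutual
    embed-local : ∀ {m} (R : FTerm (Fin m)) q A → embed R q ≡ nt A → LocalOK (sub (embed R) q)
    embed-local (fvar f)     []      A  ()
    embed-local (fvar f)     (k ∷ q) A  ()
    embed-local (fnode A us) []      A' e =
      local-intro {embed (fnode A us)} refl (λ k → embedV-root us k , (λ ge → embedV-beyond us k ge []))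
    embed-local (fnode A us) (k ∷ q) A' e = embedV-local us k q A' e

    embedV-local : ∀ {m n} (us : Vec (FTerm (Fin m)) n) k q A → embedV us k q ≡ nt A → LocalOK (sub (embedV us k) q)
    embedV-local []       k       q A ()
    embedV-local (u ∷ us) zero    q A e = embed-local u q A e
    embedV-local (u ∷ us) (suc k) q A e = embedV-local us k q A e

  step-wf : ∀ {T a X} → WF T → Step T a X → WF X
  step-wf {T} (_ , lo) (r , _ , _ , head≡ , X≈) =
    wf-resp X≈ (wf-subst (embed (rhs r)) (child T) (embed-root (rhs r)) (embed-local (rhs r)) child-wf)
    where
    child-wf : ∀ p j → embed (rhs r) p ≡ var j → WF (child T j)
    child-wf p j e = proj₁ (local-elim head≡ (lo []) j) (embed-var< (rhs r) p j e) , (λ q → lo (j ∷ q))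

  ∼-subst : ∀ k E F σ → WF E → WF F → E ∼⟨ k ⟩ F → subst E σ ∼⟨ k ⟩ subst F σ
  ∼-subst zero E F σ wE wF s = tt
  ∼-subst (suc k) E F σ wE wF s@((v₁ , v₂) , fwd , bwd) with rootView E | rootView F
  ... | root-none eq | _            = ⊥-elim (proj₁ wE eq)
  ... | _            | root-none eq = ⊥-elim (proj₁ wF eq)
  ... | root-var i eq | _ =
    ∼-respˡ (suc k) (≈-sym (subst-var E σ i eq)) (≈⇒∼ (suc k) (≈-sym (subst-var F σ i (v₁ i (wf-var wE eq) []))))
  ... | root-nt A eq | root-var j eF = ⊥-elim (nt≢var (trans (sym eq) (v₂ j (wf-var wF eF) [])))
  ... | root-nt A eq | root-nt B eF =
    ((λ i x → ⊥-elim (nt≢var (trans (sym (subst-root E σ A eq)) (x [])))) ,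
     (λ i x → ⊥-elim (nt≢var (trans (sym (subst-root F σ B eF)) (x []))))) ,
    (λ a X st → let (E' , stE , e) = step-unsubst {E} σ eq st ; (F' , stF , s') = fwd a E' stE in
       subst F' σ , step-subst {F} σ stF ,
       ∼-respˡ k (≈-sym e) (∼-subst k E' F' σ (step-wf wE stE) (step-wf wF stF) s')) ,
    (λ a X st → let (F' , stF , e) = step-unsubst {F} σ eF st ; (E' , stE , s') = bwd a F' stF in
       subst E' σ , step-subst {E} σ stE ,
       ∼-respʳ k (≈-sym e) (∼-subst k E' F' σ (step-wf wE stE) (step-wf wF stF) s'))

  -- Classical reasoning is confined to the double-negation monad; the final
  -- statement is an inequality of naturals, which is stable.
  open RawMonad (¬¬-Monad {Level.zero}) using (pure; _>>=_)

  SubtermsAtMost : Tree → ℕ → Set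
  SubtermsAtMost T s = Σ (List Tree) λ Us → length Us ≤ s × (∀ U → U ⊑ T → Any (U ≈_) Us)

  atMost-mono : ∀ {T s s'} → s ≤ s' → SubtermsAtMost T s → SubtermsAtMost T s'
  atMost-mono le (Us , len , covers) = Us , ≤-trans len le , covers

  presSize⇒atMost : ∀ {T k} → HasPresSize T k → SubtermsAtMost T k
  presSize⇒atMost (Us , len , _ , _ , covers) = Us , ≤-reflexive len , covers

  ⊑-respˡ : ∀ {U U' T} → U ≈ U' → U ⊑ T → U' ⊑ T
  ⊑-respˡ e (p , p∈ , U≈) = p , p∈ , ≈-trans (≈-sym e) U≈

  ⊑-respʳ : ∀ {U T T'} → T ≈ T' → U ⊑ T → U ⊑ T'
  ⊑-respʳ {U} {T} {T'} e (p , p∈ , U≈) = p , (λ z → p∈ (trans (e p) z)) , ≈-trans U≈ (sub-cong T T' p e)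

  atMost-resp : ∀ {T T' s} → T ≈ T' → SubtermsAtMost T s → SubtermsAtMost T' s
  atMost-resp e (Us , len , covers) = Us , len , (λ U u → covers U (⊑-respʳ (≈-sym e) u))

  thin : ∀ T (Us : List Tree) → DoubleNegation (Σ (List Tree) λ Ds → length Ds ≤ length Us ×
           All (_⊑ T) Ds × AllPairs (λ U U' → ¬ (U ≈ U')) Ds ×
           (∀ U → Any (U ≈_) Us → U ⊑ T → Any (U ≈_) Ds))
  thin T []       = pure ([] , z≤n , [] , [] , (λ U ()))
  thin T (X ∷ Us) = thin T Us >>= λ where
    (Ds , len , sub-Ds , distinct , covers) → ¬¬-excluded-middle >>= λ where
      (no X⋢T) → pure (Ds , m≤n⇒m≤1+n len , sub-Ds , distinct , λ where
         U (here e)  u → ⊥-elim (X⋢T (⊑-respˡ e u))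
         U (there a) u → covers U a u)
      (yes X⊑T) → ¬¬-excluded-middle >>= λ where
        (yes a) → pure (Ds , m≤n⇒m≤1+n len , sub-Ds , distinct , λ where
           U (here e)   u → Any.map (≈-trans e) a
           U (there a') u → covers U a' u)
        (no a) → pure (X ∷ Ds , s≤s len , X⊑T ∷ sub-Ds , Allₚ.¬Any⇒All¬ Ds a ∷ distinct , λ where
           U (here e)   u → here e
           U (there a') u → there (covers U a' u))

  atMost⇒presSize : ∀ {T s} → SubtermsAtMost T s → DoubleNegation (Σ ℕ λ k → k ≤ s × HasPresSize T k)
  atMost⇒presSize {T} (Us , len , covers) = thin T Us >>= λ where
    (Ds , len' , sub-Ds , distinct , covers') →
      pure (length Ds , ≤-trans len' len , Ds , refl , sub-Ds , distinct , λ U u → covers' U (covers U u) u)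

  root-nonempty : ∀ {X Y} q → ¬ (X q ≡ none) → sub X q ≈ Y → ¬ (Y [] ≡ none)
  root-nonempty {X} q q∈ h z = q∈ (trans (sym (sub-root X q)) (trans (h []) z))

  subterm-subst : ∀ T ρ U → U ⊑ subst T ρ →
    (Σ Tree λ S → S ⊑ T × U ≈ subst S ρ) ⊎
    (Σ ℕ λ j → Σ (List ℕ) λ q' → Σ (List ℕ) λ p → T p ≡ var j × ¬ (ρ j q' ≡ none) × U ≈ sub (ρ j) q')
  subterm-subst T ρ U (q , q∈ , e) with positionView T ρ q
  ... | at-nt A eq h = inj₁ (sub T q , (q , (λ z → nt≢none (trans (sym eq) z)) , ≈-refl) , ≈-trans e h)
  ... | in-var p q' j _ e₂ h =
    inj₂ (j , q' , p , e₂ , (λ z → root-nonempty q q∈ h (trans (sub-root (ρ j) q') z)) , ≈-trans e h)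
  ... | in-empty h = ⊥-elim (root-nonempty q q∈ h refl)

  V-atMost : ∀ i → SubtermsAtMost (V i) 1
  V-atMost i = V i ∷ [] , ≤-refl , λ where
    U ([] , _ , e)     → here e
    U (k ∷ q , q∈ , e) → ⊥-elim (q∈ refl)

  V-term : ∀ i → IsTerm (V i)
  V-term i = wf-V i , 1 , V i ∷ [] , refl , (([] , (λ ()) , ≈-refl) ∷ []) , ([] ∷ []) , proj₂ (proj₂ (V-atMost i))

  mutual
    subterms : ∀ {m} → FTerm (Fin m) → List Tree
    subterms (fvar f)     = embed (fvar f) ∷ []
    subterms (fnode A us) = embed (fnode A us) ∷ subtermsV us

    subtermsV : ∀ {m n} → Vec (FTerm (Fin m)) n → List Tree
    subtermsV []       = []
    subtermsV (u ∷ us) = subterms u ++ subtermsV us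

  mutual
    subterms-complete : ∀ {m} (R : FTerm (Fin m)) q → ¬ (embed R q ≡ none) →
                        Any (sub (embed R) q ≈_) (subterms R)
    subterms-complete (fvar f)     []      q∈ = here ≈-refl
    subterms-complete (fvar f)     (k ∷ q) q∈ = ⊥-elim (q∈ refl)
    subterms-complete (fnode A us) []      q∈ = here ≈-refl
    subterms-complete (fnode A us) (k ∷ q) q∈ = there (subtermsV-complete us k q q∈)

    subtermsV-complete : ∀ {m n} (us : Vec (FTerm (Fin m)) n) k q → ¬ (embedV us k q ≡ none) →
                         Any (sub (embedV us k) q ≈_) (subtermsV us)
    subtermsV-complete []       k       q q∈ = ⊥-elim (q∈ refl)
    subtermsV-complete (u ∷ us) zero    q q∈ = Anyₚ.++⁺ˡ (subterms-complete u q q∈)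
    subtermsV-complete (u ∷ us) (suc k) q q∈ = Anyₚ.++⁺ʳ (subterms u) (subtermsV-complete us k q q∈)

  embed-atMost : ∀ {m} (R : FTerm (Fin m)) → SubtermsAtMost (embed R) (length (subterms R))
  embed-atMost R = subterms R , ≤-refl , λ where
    U (q , q∈ , e) → Any.map (≈-trans e) (subterms-complete R q q∈)

  instance-atMost : ∀ {T k s} R → SubtermsAtMost R k → SubtermsAtMost T s →
                    SubtermsAtMost (subst R (child T)) (k + s)
  instance-atMost {T} {k} {s} R (Rs , lenR , coversR) (Ts , lenT , coversT) =
    map inst Rs ++ Ts , ≤-trans (≤-reflexive length-eq) (+-mono-≤ lenR lenT) , covers
    where
    inst : Tree → Tree
    inst S = subst S (child T)
    length-eq : length (map inst Rs ++ Ts) ≡ length Rs + length Ts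
    length-eq = trans (length-++ (map inst Rs)) (cong (_+ length Ts) (length-map inst Rs))
    covers : ∀ U → U ⊑ subst R (child T) → Any (U ≈_) (map inst Rs ++ Ts)
    covers U u with subterm-subst R (child T) U u
    ... | inj₁ (S , S⊑R , e) =
      Anyₚ.++⁺ˡ (Anyₚ.map⁺ (Any.map (λ z → ≈-trans e (subst-congˡ _ _ (child T) z)) (coversR S S⊑R)))
    ... | inj₂ (j , q' , _ , _ , q∈ , e) = Anyₚ.++⁺ʳ (map inst Rs) (coversT U (j ∷ q' , q∈ , e))

  step-atMost : ∀ {sinc} → IsSInc sinc → ∀ {T a X s} → Step T a X → SubtermsAtMost T s →
                DoubleNegation (SubtermsAtMost X (sinc + s))
  step-atMost {sinc} sinc-max {s = s} (r , r∈ , _ , _ , X≈) T-bound =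
    atMost⇒presSize (embed-atMost (rhs r)) >>= λ where
      (k , _ , size) → pure (atMost-resp (≈-sym X≈)
        (atMost-mono (+-monoˡ-≤ s (proj₁ sinc-max r r∈ k size))
          (instance-atMost (embed (rhs r)) (presSize⇒atMost size) T-bound)))

  -- Let Eσ ∼ₘ Fσ and e ≤ m.  Playing the bisimulation game
  -- on E, F for e rounds, either E ∼ₑ F, or after ℓ < e rounds we reach a
  -- pair (x_i, Y) (or (Y, x_i)) with Y ≠ x_i, giving σ(x_i) ∼_{m-ℓ} Yσ.
  module Decomposition (σ : ℕ → Tree) (sinc : ℕ) (sinc-max : IsSInc sinc) where

    -- The outcome of the second alternative; Y is reached in ℓ steps from
    -- terms with at most s subterms, so it has at most s + ℓ·SInc subterms.
    VarWitness : ℕ → ℕ → ℕ → Set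
    VarWitness e m s = Σ ℕ λ ℓ → ℓ < e × Σ ℕ λ i → Σ Tree λ Y → WF Y ×
      DoubleNegation (SubtermsAtMost Y (s + ℓ * sinc)) × ¬ (Y [] ≡ var i) × σ i ∼⟨ m ∸ ℓ ⟩ subst Y σ

    witness-now : ∀ {e m s} i Y → WF Y → DoubleNegation (SubtermsAtMost Y s) → ¬ (Y [] ≡ var i) →
                  σ i ∼⟨ m ⟩ subst Y σ → VarWitness (suc e) m s
    witness-now {s = s} i Y wY bY Y≢xᵢ sim =
      0 , s≤s z≤n , i , Y , wY , (bY >>= λ b → pure (atMost-mono (m≤m+n s 0) b)) , Y≢xᵢ , sim

    witness-later : ∀ {e m s} → VarWitness e m (sinc + s) → VarWitness (suc e) (suc m) s
    witness-later {s = s} (ℓ , ℓ<e , i , Y , wY , bY , Y≢xᵢ , sim) =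
      suc ℓ , s≤s ℓ<e , i , Y , wY , (bY >>= λ b → pure (atMost-mono (≤-reflexive size-eq) b)) , Y≢xᵢ , sim
      where
      size-eq : (sinc + s) + ℓ * sinc ≡ s + suc ℓ * sinc
      size-eq = trans (cong (_+ ℓ * sinc) (+-comm sinc s)) (+-assoc s sinc (ℓ * sinc))

    decompose : ∀ e E F m s → WF E → WF F →
                DoubleNegation (SubtermsAtMost E s) → DoubleNegation (SubtermsAtMost F s) →
                subst E σ ∼⟨ m ⟩ subst F σ → e ≤ m → ¬ VarWitness e m s → E ∼⟨ e ⟩ F
    decompose zero E F m s wE wF bE bF sim e≤m no-witness = tt
    decompose (suc e) E F m s wE wF bE bF sim e≤m no-witness with rootView E | rootView F
    ... | root-none eq | _            = ⊥-elim (proj₁ wE eq)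
    ... | _            | root-none eq = ⊥-elim (proj₁ wF eq)
    ... | root-var i eq | root-var j eF with i ≟ j
    ...   | yes refl = ∼-respˡ (suc e) (≈-sym (wf-var wE eq)) (≈⇒∼ (suc e) (≈-sym (wf-var wF eF)))
    ...   | no i≢j   = ⊥-elim (no-witness (witness-now i F wF bF
                         (λ z → i≢j (sym (var-injective (trans (sym eF) z)))) (∼-respˡ m (subst-var E σ i eq) sim)))
    decompose (suc e) E F m s wE wF bE bF sim e≤m no-witness | root-var i eq | root-nt B eF =
      ⊥-elim (no-witness (witness-now i F wF bF (λ z → nt≢var (trans (sym eF) z)) (∼-respˡ m (subst-var E σ i eq) sim)))
    decompose (suc e) E F m s wE wF bE bF sim e≤m no-witness | root-nt A eq | root-var j eF =
      ⊥-elim (no-witness (witness-now j E wE bE (λ z → nt≢var (trans (sym eq) z))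
        (∼-sym m (∼-respʳ m (subst-var F σ j eF) sim))))
    decompose (suc e) E F (suc m) s wE wF bE bF ((v₁ , v₂) , fwd , bwd) (s≤s e≤m) no-witness
      | root-nt A eq | root-nt B eF =
      ((λ i x → ⊥-elim (nt≢var (trans (sym eq) (x [])))) , (λ i x → ⊥-elim (nt≢var (trans (sym eF) (x []))))) ,
      (λ a E' stE → let (U , stU , sU) = fwd a (subst E' σ) (step-subst {E} σ stE)
                        (F' , stF , U≈) = step-unsubst {F} σ eF stU in
         F' , stF , successors E' F' stE stF (∼-respʳ m U≈ sU)) ,
      (λ a F' stF → let (U , stU , sU) = bwd a (subst F' σ) (step-subst {F} σ stF)
                        (E' , stE , U≈) = step-unsubst {E} σ eq stU in
         E' , stE , successors E' F' stE stF (∼-respˡ m U≈ sU))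
      where
      successors : ∀ {a b} E' F' → Step E a E' → Step F b F' → subst E' σ ∼⟨ m ⟩ subst F' σ → E' ∼⟨ e ⟩ F'
      successors E' F' stE stF sim' =
        decompose e E' F' m (sinc + s) (step-wf wE stE) (step-wf wF stF)
          (bE >>= step-atMost sinc-max stE) (bF >>= step-atMost sinc-max stF) sim' e≤m (no-witness ∘ witness-later)

  V-below : ∀ j k q → sub (V j) (k ∷ q) ≈ Void
  V-below j k q r = sub-++ (child (V j) k) q r

  -- Given a term H ≠ x_i, the regular term
  -- Hω = H[x_i ≔ H[x_i ≔ …]] is the solution of  Hω = H[x_i ≔ Hω].
  -- Replacing x_i by Hω in all pairs and resetting σ(x_i) to x_i preserves
  -- ∼ₘ whenever σ(x_i) ∼ₘ Hσ, and removes x_i from the support of σ.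
  module Elimination (H : Tree) (i : ℕ) (H≢xᵢ : ¬ (H [] ≡ var i)) where

    -- Hω is read off along a path; a jump back to the root of H happens
    -- only after reading a successor index, which makes the recursion
    -- structural in the path.
    mutual
      walk : Tree → List ℕ → Label
      walk T p = walkFrom (T []) T p

      walkFrom : Label → Tree → List ℕ → Label
      walkFrom (var j) T p       = walkVar j (j ≟ i) p
      walkFrom (nt A)  T []      = nt A
      walkFrom (nt A)  T (k ∷ p) = walk (child T k) p
      walkFrom none    T p       = none

      walkVar : ∀ j → Dec (j ≡ i) → List ℕ → Label
      walkVar j (yes _) p = Hω p
      walkVar j (no _)  p = V j p

      Hω : Tree
      Hω p = unfold (H []) p

      unfold : Label → List ℕ → Label
      unfold l       []      = l
      unfold (nt A)  (k ∷ p) = walk (child H k) p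
      unfold (var _) (k ∷ p) = none
      unfold none    (k ∷ p) = none

    xᵢ↦Hω : ℕ → Tree
    xᵢ↦Hω j = walkVar j (j ≟ i)

    xᵢ↦Hω-i : xᵢ↦Hω i ≈ Hω
    xᵢ↦Hω-i with i ≟ i
    ... | yes _   = ≈-refl
    ... | no  i≢i = ⊥-elim (i≢i refl)

    xᵢ↦Hω-j : ∀ j → ¬ (j ≡ i) → xᵢ↦Hω j ≈ V j
    xᵢ↦Hω-j j j≢i with j ≟ i
    ... | yes j≡i = ⊥-elim (j≢i j≡i)
    ... | no  _   = ≈-refl

    walk-subst : ∀ T → walk T ≈ subst T xᵢ↦Hω
    walk-subst T p with rootView T
    ... | root-var j eq = trans (cong (λ l → walkFrom l T p) eq) (sym (subst-var T xᵢ↦Hω j eq p))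
    ... | root-none eq  = trans (cong (λ l → walkFrom l T p) eq) (sym (subst-none T xᵢ↦Hω eq p))
    walk-subst T [] | root-nt A eq =
      trans (cong (λ l → walkFrom l T []) eq) (sym (subst-root T xᵢ↦Hω A eq))
    walk-subst T (k ∷ p) | root-nt A eq =
      trans (cong (λ l → walkFrom l T (k ∷ p)) eq)
        (trans (walk-subst (child T k) p) (sym (subst-child T xᵢ↦Hω A eq k p)))

    unfold-walk : ∀ l → ¬ (l ≡ var i) → ∀ p → unfold l p ≡ walkFrom l H p
    unfold-walk (var j) l≢xᵢ p with j ≟ i
    ... | yes refl = ⊥-elim (l≢xᵢ refl)
    unfold-walk (var j) l≢xᵢ []      | no _ = refl
    unfold-walk (var j) l≢xᵢ (k ∷ p) | no _ = refl
    unfold-walk (nt A)  _    []      = refl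
    unfold-walk (nt A)  _    (k ∷ p) = refl
    unfold-walk none    _    []      = refl
    unfold-walk none    _    (k ∷ p) = refl

    Hω-unfold : Hω ≈ subst H xᵢ↦Hω
    Hω-unfold p = trans (unfold-walk (H []) H≢xᵢ p) (walk-subst H p)

    -- Every position of Hω lies inside a copy of H at a position that is a
    -- nonterminal, a variable other than x_i, or empty: occurrences of x_i
    -- are always unfolded further, along a strictly shorter remaining path.
    data LimitPosition (q : List ℕ) : Set where
      lim-nt    : ∀ p A → H p ≡ nt A → sub Hω q ≈ subst (sub H p) xᵢ↦Hω → LimitPosition q
      lim-var   : ∀ p j → H p ≡ var j → ¬ (j ≡ i) → sub Hω q ≈ V j → LimitPosition q
      lim-empty : sub Hω q ≈ Void → LimitPosition q

    limitPosition : ∀ q → LimitPosition q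
    limitPosition q = bounded (suc (length q)) q ≤-refl
      where
      shorter : ∀ {q k} p q' → q ≡ k ∷ (p ++ q') → length q' < length q
      shorter p q' refl = s≤s (≤-trans (m≤n+m (length q') (length p)) (≤-reflexive (sym (length-++ p))))

      transport : ∀ {q q'} → sub Hω q ≈ sub Hω q' → LimitPosition q' → LimitPosition q
      transport e (lim-nt p A eq h)     = lim-nt p A eq (≈-trans e h)
      transport e (lim-var p j eq ne h) = lim-var p j eq ne (≈-trans e h)
      transport e (lim-empty h)         = lim-empty (≈-trans e h)

      unfold-at : ∀ q → sub Hω q ≈ sub (subst H xᵢ↦Hω) q
      unfold-at q = sub-cong Hω (subst H xᵢ↦Hω) q Hω-unfold

      outside-xᵢ : ∀ {q} p j q' → H p ≡ var j → ¬ (j ≡ i) → sub Hω q ≈ sub (V j) q' → LimitPosition q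
      outside-xᵢ p j []       eq j≢i h = lim-var p j eq j≢i h
      outside-xᵢ p j (k ∷ q') eq j≢i h = lim-empty (≈-trans h (V-below j k q'))

      bounded : ∀ n q → length q < n → LimitPosition q
      bounded (suc n) q (s≤s q<n) with positionView H xᵢ↦Hω q
      ... | at-nt A eq h = lim-nt q A eq (≈-trans (unfold-at q) h)
      ... | in-empty h   = lim-empty (≈-trans (unfold-at q) h)
      ... | in-var p q' j q≡ eq h with j ≟ i
      ...   | no j≢i = outside-xᵢ p j q' eq j≢i (≈-trans (unfold-at q) h)
      bounded (suc n) q (s≤s q<n) | in-var [] q' j q≡ eq h | yes refl = ⊥-elim (H≢xᵢ eq)
      bounded (suc n) q (s≤s q<n) | in-var (k ∷ p) q' j q≡ eq h | yes refl =
        transport (≈-trans (unfold-at q) h)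
          (bounded n q' (≤-trans (shorter p q' q≡) q<n))

    Hω-subterm : ∀ U → U ⊑ Hω → Σ Tree λ S → S ⊑ H × U ≈ subst S xᵢ↦Hω
    Hω-subterm U (q , q∈ , U≈) with limitPosition q
    ... | lim-nt p A eq h = sub H p , (p , (λ z → nt≢none (trans (sym eq) z)) , ≈-refl) , ≈-trans U≈ h
    ... | lim-var p j eq j≢i h =
      sub H p , (p , (λ z → var≢none (trans (sym eq) z)) , ≈-refl) ,
      ≈-trans U≈ (≈-trans h (≈-trans (≈-sym (xᵢ↦Hω-j j j≢i))
        (≈-sym (subst-var (sub H p) xᵢ↦Hω j (trans (sub-root H p) eq)))))
    ... | lim-empty h = ⊥-elim (root-nonempty q q∈ h refl)

    eliminated-atMost : ∀ {E kE kH} → SubtermsAtMost E kE → SubtermsAtMost H kH →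
                        SubtermsAtMost (subst E xᵢ↦Hω) (kE + kH)
    eliminated-atMost {E} (Es , lenE , coversE) (Hs , lenH , coversH) =
      map inst (Es ++ Hs) ,
      ≤-trans (≤-reflexive (trans (length-map inst (Es ++ Hs)) (length-++ Es))) (+-mono-≤ lenE lenH) , covers
      where
      inst : Tree → Tree
      inst S = subst S xᵢ↦Hω
      instance-of : ∀ {U} S → U ≈ inst S → Any (S ≈_) (Es ++ Hs) → Any (U ≈_) (map inst (Es ++ Hs))
      instance-of S e a = Anyₚ.map⁺ (Any.map (λ z → ≈-trans e (subst-congˡ _ _ xᵢ↦Hω z)) a)
      covers : ∀ U → U ⊑ subst E xᵢ↦Hω → Any (U ≈_) (map inst (Es ++ Hs))
      covers U u with subterm-subst E xᵢ↦Hω U u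
      ... | inj₁ (S , S⊑E , e) = instance-of S e (Anyₚ.++⁺ˡ (coversE S S⊑E))
      ... | inj₂ (j , q' , p , eq , q∈ , e) with j ≟ i
      ...   | yes refl = let (S , S⊑H , e') = Hω-subterm U (q' , q∈ , e) in
                         instance-of S e' (Anyₚ.++⁺ʳ Es (coversH S S⊑H))
      ...   | no j≢i with q'
      ...     | k ∷ _ = ⊥-elim (q∈ refl)
      ...     | []    = instance-of (sub E p)
                          (≈-trans e (≈-trans (≈-sym (xᵢ↦Hω-j j j≢i))
                            (≈-sym (subst-var (sub E p) xᵢ↦Hω j (trans (sub-root E p) eq)))))
                          (Anyₚ.++⁺ˡ (coversE (sub E p) (p , (λ z → var≢none (trans (sym eq) z)) , ≈-refl)))

    module _ (wH : WF H) where
      xᵢ↦Hω-root : ∀ j → ¬ (xᵢ↦Hω j [] ≡ none)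
      xᵢ↦Hω-root j with j ≟ i
      ... | yes _ = proj₁ wH
      ... | no  _ = λ ()

      Hω-wf : WF Hω
      Hω-wf = proj₁ wH , local
        where
        local : ∀ q → LocalOK (sub Hω q)
        local q with limitPosition q
        ... | lim-nt p A eq h =
          local-resp (≈-sym h) (local-subst-nt (sub H p) xᵢ↦Hω A (trans (sub-root H p) eq) (proj₂ wH p)
            (λ _ j _ → xᵢ↦Hω-root j))
        ... | lim-var _ j _ _ h = local-resp (≈-sym h) (proj₂ (wf-V j) [])
        ... | lim-empty h       = local-resp (≈-sym h) Void-local

      xᵢ↦Hω-wf : ∀ j → WF (xᵢ↦Hω j)
      xᵢ↦Hω-wf j with j ≟ i
      ... | yes _ = Hω-wf
      ... | no  _ = wf-V j

      eliminated-wf : ∀ {E} → WF E → WF (subst E xᵢ↦Hω)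
      eliminated-wf {E} (E≢none , lo) = wf-subst E xᵢ↦Hω E≢none (λ q _ _ → lo q) (λ _ j _ → xᵢ↦Hω-wf j)

    without : (ℕ → Tree) → ℕ → Tree
    without σ j with j ≟ i
    ... | yes _ = V i
    ... | no  _ = σ j

    without-i : ∀ σ → without σ i ≈ V i
    without-i σ with i ≟ i
    ... | yes _   = ≈-refl
    ... | no  i≢i = ⊥-elim (i≢i refl)

    without-j : ∀ σ j → ¬ (j ≡ i) → without σ j ≈ σ j
    without-j σ j j≢i with j ≟ i
    ... | yes j≡i = ⊥-elim (j≢i j≡i)
    ... | no  _   = ≈-refl

    without-support : ∀ σ xs n → (∀ j → ¬ (j ∈ xs) → σ j ≈ V j) → i ∈ xs → length xs ≤ suc n →
                      SuppAtMost (without σ) n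
    without-support σ xs n outside i∈xs len =
      filter (λ x → ¬? (x ≟ i)) xs ,
      ≤-pred (≤-trans (filter-notAll (λ x → ¬? (x ≟ i)) xs (Any.map (λ i≡x x≢i → x≢i (sym i≡x)) i∈xs)) len) ,
      outside'
      where
      outside' : ∀ j → ¬ (j ∈ filter (λ x → ¬? (x ≟ i)) xs) → without σ j ≈ V j
      outside' j j∉ = by-cases (j ≟ i)
        where
        by-cases : Dec (j ≡ i) → without σ j ≈ V j
        by-cases (yes j≡i) = Eq.subst (λ x → without σ x ≈ V x) (sym j≡i) (without-i σ)
        by-cases (no  j≢i) = ≈-trans (without-j σ j j≢i) (outside j (λ j∈ → j∉ (∈-filter⁺ (λ x → ¬? (x ≟ i)) j∈ j≢i)))

    without-terms : ∀ σ → (∀ j → IsTerm (σ j)) → ∀ j → IsTerm (without σ j)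
    without-terms σ terms j with j ≟ i
    ... | yes _ = V-term i
    ... | no  _ = terms j

    eliminate-then-σ : ∀ σ j → ¬ (j ≡ i) → subst (xᵢ↦Hω j) (without σ) ≈ σ j
    eliminate-then-σ σ j j≢i = ≈-trans (subst-congˡ _ (V j) (without σ) (xᵢ↦Hω-j j j≢i)) (without-j σ j j≢i)

    -- If σ(x_i) ∼ₘ Hσ then σ(x_i) ∼ₖ Hω(σ without x_i) for every k ≤ m; by
    -- induction on k, using Hω = H[x_i ≔ Hω] and that H is not x_i.
    Hω-matches : ∀ σ m → σ i ∼⟨ m ⟩ subst H σ → ∀ k → k ≤ m → σ i ∼⟨ k ⟩ subst Hω (without σ)
    Hω-matches σ m sim zero    k≤m = tt
    Hω-matches σ m sim (suc k) k≤m =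
      ∼-respʳ (suc k) (≈-sym Hω-instance)
        (∼-trans (suc k) (∼-mono k≤m sim)
          (∼-congʳ-except k H i σ τ H≢xᵢ
            (∼-respʳ k (≈-sym τ-i) (Hω-matches σ m sim k (≤-trans (n≤1+n k) k≤m)))
            (λ j j≢i → ≈⇒∼ (suc k) (≈-sym (eliminate-then-σ σ j j≢i)))))
      where
      τ : ℕ → Tree
      τ j = subst (xᵢ↦Hω j) (without σ)
      τ-i : τ i ≈ subst Hω (without σ)
      τ-i = subst-congˡ (xᵢ↦Hω i) Hω (without σ) xᵢ↦Hω-i
      Hω-instance : subst Hω (without σ) ≈ subst H τ
      Hω-instance = ≈-trans (subst-congˡ Hω (subst H xᵢ↦Hω) (without σ) Hω-unfold) (subst-subst H xᵢ↦Hω (without σ))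

    transfer : ∀ σ m → σ i ∼⟨ m ⟩ subst H σ → ∀ E → subst E σ ∼⟨ m ⟩ subst (subst E xᵢ↦Hω) (without σ)
    transfer σ m sim E = ∼-respʳ m (≈-sym (subst-subst E xᵢ↦Hω (without σ))) (∼-congʳ m E σ _ pointwise)
      where
      pointwise : ∀ j → σ j ∼⟨ m ⟩ subst (xᵢ↦Hω j) (without σ)
      pointwise j = by-cases (j ≟ i)
        where
        by-cases : Dec (j ≡ i) → σ j ∼⟨ m ⟩ subst (xᵢ↦Hω j) (without σ)
        by-cases (yes j≡i) = Eq.subst (λ x → σ x ∼⟨ m ⟩ subst (xᵢ↦Hω x) (without σ)) (sym j≡i)
          (∼-respʳ m (≈-sym (subst-congˡ (xᵢ↦Hω i) Hω (without σ) xᵢ↦Hω-i)) (Hω-matches σ m sim m ≤-refl))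
        by-cases (no  j≢i) = ≈⇒∼ m (≈-sym (eliminate-then-σ σ j j≢i))

  eql-max : ∀ {T U a b} → EqLIs T U (fin a) → T ∼⟨ b ⟩ U → b ≤ a
  eql-max (_ , maximal) s = maximal _ s

  eql-transfer : ∀ {e m A B A' B'} → suc e ≤ m → A ∼⟨ m ⟩ A' → B ∼⟨ m ⟩ B' →
                 EqLIs A B (fin e) → EqLIs A' B' (fin e)
  eql-transfer {e} e<m sA sB (s , maximal) =
    ∼-trans e (∼-sym e (∼-mono e≤m sA)) (∼-trans e s (∼-mono e≤m sB)) , maximal'
    where
    e≤m : e ≤ _
    e≤m = ≤-trans (n≤1+n e) e<m
    maximal' : ∀ k → _ ∼⟨ k ⟩ _ → k ≤ e
    maximal' k s' with k ≤? e
    ... | yes k≤e = k≤e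
    ... | no  k≰e = ⊥-elim (<-irrefl refl (maximal (suc e)
            (∼-trans (suc e) (∼-mono e<m sA) (∼-trans (suc e) (∼-mono (≰⇒> k≰e) s') (∼-sym (suc e) (∼-mono e<m sB))))))

  strictly-decreasing : ∀ L (e : ℕ → ℕ) → (∀ j → 1 ≤ j → j < L → e (suc j) < e j) →
                        ∀ j → 1 ≤ j → j ≤ L → e j + j ≤ e 1 + 1
  strictly-decreasing L e dec (suc zero)    _ _   = ≤-refl
  strictly-decreasing L e dec (suc (suc j)) _ j<L =
    ≤-trans (≤-reflexive (+-suc (e (suc (suc j))) (suc j)))
      (≤-trans (+-monoˡ-≤ (suc j) (dec (suc j) (s≤s z≤n) j<L))
        (strictly-decreasing L e dec (suc j) (s≤s z≤n) (<⇒≤ j<L)))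

  ¬¬-finite-choice : ∀ (P : ℕ → Set) N → (∀ j → 1 ≤ j → j ≤ N → DoubleNegation (P j)) →
                     DoubleNegation (∀ j → 1 ≤ j → j ≤ N → P j)
  ¬¬-finite-choice P zero    h = pure (λ j 1≤j j≤0 → ⊥-elim (<⇒≱ 1≤j j≤0))
  ¬¬-finite-choice P (suc N) h =
    ¬¬-finite-choice P N (λ j 1≤j j≤N → h j 1≤j (m≤n⇒m≤1+n j≤N)) >>= λ upto-N →
    h (suc N) (s≤s z≤n) ≤-refl >>= λ at-N+1 → pure (combine upto-N at-N+1)
    where
    combine : (∀ j → 1 ≤ j → j ≤ N → P j) → P (suc N) → ∀ j → 1 ≤ j → j ≤ suc N → P j
    combine upto-N at-N+1 j 1≤j j≤N+1 with j ≟ suc N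
    ... | yes refl = at-N+1
    ... | no  j≢   = upto-N j 1≤j (≤-pred (≤∧≢⇒< j≤N+1 j≢))

  pairSize-mono : ∀ {E F a b} → a ≤ b → PairSizeLe E F a → PairSizeLe E F b
  pairSize-mono le (wE , wF , k₁ , k₂ , s₁ , s₂ , k≤a) = wE , wF , k₁ , k₂ , s₁ , s₂ , ≤-trans k≤a le

  ∈⇒nonempty : ∀ {x : ℕ} {xs} → x ∈ xs → 0 < length xs
  ∈⇒nonempty (here _)  = s≤s z≤n
  ∈⇒nonempty (there _) = s≤s z≤n

  level-gap : ∀ a M j b → 1 ≤ j → a + (suc M + j) ≤ b + 1 → suc a ≤ b ∸ M
  level-gap a M j b 1≤j h = m+n≤o⇒m≤o∸n (suc a) (≤-pred (begin
    suc (suc a + M)   ≡⟨ shuffle a M ⟩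
    a + (suc M + 1)   ≤⟨ +-monoʳ-≤ a (+-monoʳ-≤ (suc M) 1≤j) ⟩
    a + (suc M + j)   ≤⟨ h ⟩
    b + 1             ≡⟨ +-comm b 1 ⟩
    suc b             ∎))
    where
    open ≤-Reasoning
    shuffle : ∀ a M → suc (suc a + M) ≡ a + (suc M + 1)
    shuffle = solve 2 (λ a M → con 1 :+ (con 1 :+ a :+ M) := a :+ (con 1 :+ M :+ con 1)) refl

  size-sum : ∀ a b c x y G' → x ≤ a + c → y ≤ b + c → a + b ≤ G' → x + y ≤ G' + 2 * c
  size-sum a b c x y G' x≤ y≤ a+b≤ =
    ≤-trans (+-mono-≤ x≤ y≤) (≤-trans (≤-reflexive (regroup a b c)) (+-monoˡ-≤ (2 * c) a+b≤))
    where
    regroup : ∀ a b c → (a + c) + (b + c) ≡ (a + b) + 2 * c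
    regroup = solve 3 (λ a b c → (a :+ c) :+ (b :+ c) := (a :+ b) :+ con 2 :* c) refl

  record Eliminable (σ : ℕ → Tree) (xs : List ℕ) (c m : ℕ) : Set where
    field
      i       : ℕ
      i∈xs    : i ∈ xs
      H       : Tree
      H-wf    : WF H
      H≢xᵢ    : ¬ (H [] ≡ var i)
      H-size  : DoubleNegation (SubtermsAtMost H c)
      matches : σ i ∼⟨ m ⟩ subst H σ

  -- A decomposition witness σ(x_i) ∼ₘ Yσ (m ≥ 1) always yields an eliminable
  -- variable: if x_i is outside the support then σ(x_i) = x_i forces Y = x_k
  -- with σ(x_k) = x_i, and x_k (matched by x_i) is in the support.
  witness-in-support : ∀ σ xs → (∀ j → ¬ (j ∈ xs) → σ j ≈ V j) → ∀ {c m} → 1 ≤ c → 1 ≤ m →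
                       ∀ i Y → WF Y → DoubleNegation (SubtermsAtMost Y c) → ¬ (Y [] ≡ var i) →
                       σ i ∼⟨ m ⟩ subst Y σ → Eliminable σ xs c m
  witness-in-support σ xs outside 1≤c 1≤m i Y wY bY Y≢xᵢ sim with i ∈? xs
  ... | yes i∈xs = record { i = i ; i∈xs = i∈xs ; H = Y ; H-wf = wY ; H≢xᵢ = Y≢xᵢ ; H-size = bY ; matches = sim }
  witness-in-support σ xs outside 1≤c (s≤s z≤n) i Y wY bY Y≢xᵢ sim@((v₁ , _) , _) | no i∉xs
    with rootView Y
  ... | root-none eq = ⊥-elim (proj₁ wY eq)
  ... | root-nt A eq = ⊥-elim (nt≢var (trans (sym (subst-root Y σ A eq)) (v₁ i (outside i i∉xs) [])))
  ... | root-var k eq with k ∈? xs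
  ...   | yes k∈xs = record
    { i = k ; i∈xs = k∈xs ; H = V i ; H-wf = wf-V i
    ; H≢xᵢ = λ z → Y≢xᵢ (trans eq (cong var (sym (var-injective z))))
    ; H-size = pure (atMost-mono 1≤c (V-atMost i))
    ; matches = ∼-respˡ _ (≈-sym σk≈xᵢ) (≈⇒∼ _ (≈-sym (outside i i∉xs))) }
    where
    σk≈xᵢ : σ k ≈ V i
    σk≈xᵢ = ≈-trans (≈-sym (subst-var Y σ k eq)) (v₁ i (outside i i∉xs))
  ...   | no k∉xs = ⊥-elim (Y≢xᵢ (trans eq (cong var (var-injective
            (trans (sym (outside k k∉xs [])) (≈-trans (≈-sym (subst-var Y σ k eq)) (v₁ i (outside i i∉xs)) []))))))

  module LengthBound (C : PairSet) (mel : ℕ → ℕ) (mel-max : ∀ b → IsMEL C b (mel b))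
                     (sinc : ℕ) (sinc-max : IsSInc sinc) (B : ℕ) where

    Admissible : ℕ → (ℕ → ℕ) → ℕ → (ℕ → Tree) → (ℕ → Tree) → Set
    Admissible n g L W W' = EqlevelDecreasing L W W' × NGSequence n g L W W' ×
      (1 ≤ L → ∀ e₁ → EqLIs (W 1) (W' 1) (fin e₁) → BelowLEqL e₁ (Rest C B))

    Claim : ℕ → Set
    Claim n = ∀ g → Positive g → Nondecreasing g → SufficientSizeBound C mel sinc n g B →
              ∀ L W W' → Admissible n g L W W' → L ≤ ell mel sinc n g

    ell-≥ : ∀ n g → 1 + mel (g 1) ≤ ell mel sinc n g
    ell-≥ zero    g = ≤-refl
    ell-≥ (suc n) g = m≤m+n _ _

    bound-g₁ : ∀ n g → SufficientSizeBound C mel sinc n g B → g 1 ≤ B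
    bound-g₁ zero    g sb = proj₂ sb
    bound-g₁ (suc n) g sb = proj₁ (proj₂ sb)

    gPrime-positive : ∀ g → Positive g → Positive (gPrime mel sinc g)
    gPrime-positive g pos j _ = ≤-trans (pos _ (s≤s z≤n)) (m≤m+n _ _)

    gPrime-nondecreasing : ∀ g → Nondecreasing g → Nondecreasing (gPrime mel sinc g)
    gPrime-nondecreasing g mono a b _ a≤b = +-monoˡ-≤ _ (mono _ _ (s≤s z≤n) (+-monoʳ-≤ (1 + mel (g 1)) a≤b))

    module Long (g : ℕ → ℕ) (pos : Positive g) (g₁≤B : g 1 ≤ B)
                (L : ℕ) (W W' : ℕ → Tree) (e : ℕ → ℕ)
                (levels : ∀ j → 1 ≤ j → j ≤ L → EqLIs (W j) (W' j) (fin (e j)))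
                (decreasing : ∀ j → 1 ≤ j → j < L → e (suc j) < e j)
                (σ E F : ℕ → Tree) (xs : List ℕ) (outside : ∀ j → ¬ (j ∈ xs) → σ j ≈ V j)
                (pairs : ∀ j → 1 ≤ j → j ≤ L →
                         W j ≈ subst (E j) σ × W' j ≈ subst (F j) σ × PairSizeLe (E j) (F j) (g j))
                (below : BelowLEqL (e 1) (Rest C B))
                (long : 1 + mel (g 1) < L) where

      M : ℕ
      M = mel (g 1)

      1≤L : 1 ≤ L
      1≤L = ≤-trans (s≤s z≤n) long

      level-bound : ∀ j → 1 ≤ j → j ≤ L → e j + j ≤ e 1 + 1
      level-bound = strictly-decreasing L e decreasing

      -- Since L ≤ e₁ + 1, the first level exceeds M.
      M<e₁ : M < e 1
      M<e₁ = ≤-pred (≤-trans long (≤-trans (m≤n+m L (e L))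
               (≤-trans (level-bound L 1≤L ≤-refl) (≤-reflexive (+-comm (e 1) 1)))))

      first-size : PairSizeLe (E 1) (F 1) (g 1)
      first-size = proj₂ (proj₂ (pairs 1 ≤-refl 1≤L))

      first-instance : subst (E 1) σ ∼⟨ e 1 ⟩ subst (F 1) σ
      first-instance = let (W≈ , W'≈ , _) = pairs 1 ≤-refl 1≤L in
        ∼-respˡ (e 1) W≈ (∼-respʳ (e 1) W'≈ (proj₁ (levels 1 ≤-refl 1≤L)))

      -- Otherwise (E₁, F₁) ∈ Rest, so E₁ ∼ₖ F₁ for some k > e₁, and then also
      -- E₁σ ∼ₖ F₁σ, contradicting EqL(E₁σ, F₁σ) = e₁.
      first-pair-in-C : DoubleNegation (C (E 1) (F 1))
      first-pair-in-C ∉C =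
        let (W≈ , W'≈ , wE , wF , _) = pairs 1 ≤-refl 1≤L
            (k , e₁<k , E∼F) = below (E 1) (F 1) (pairSize-mono g₁≤B first-size , ∉C) in
        <⇒≱ e₁<k (eql-max (levels 1 ≤-refl 1≤L)
          (∼-respˡ k (≈-sym W≈) (∼-respʳ k (≈-sym W'≈) (∼-subst k (E 1) (F 1) σ wE wF E∼F))))

      open Decomposition σ sinc sinc-max

      -- As (E₁, F₁) ∈ C ∩ Size_{≤g(1)} we have E₁ ≁_{M+1} F₁, while
      -- E₁σ ∼_{e₁} F₁σ with M < e₁; so decomposition must yield a witness.
      decomposition-witness : DoubleNegation (VarWitness (suc M) (e 1) (g 1))
      decomposition-witness no-witness = first-pair-in-C λ ∈C →
        let (wE , wF , k₁ , k₂ , sE , sF , k≤) = first-size in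
        n≮n M (proj₁ (mel-max (g 1)) (E 1) (F 1) first-size ∈C (suc M)
          (decompose (suc M) (E 1) (F 1) (e 1) (g 1) wE wF
            (pure (atMost-mono (≤-trans (m≤m+n k₁ k₂) k≤) (presSize⇒atMost sE)))
            (pure (atMost-mono (≤-trans (m≤n+m k₂ k₁) k≤) (presSize⇒atMost sF)))
            first-instance M<e₁ no-witness))

      eliminable : DoubleNegation (Eliminable σ xs (g 1 + M * sinc) (e 1 ∸ M))
      eliminable = decomposition-witness >>= λ (ℓ , ℓ<M+1 , i , Y , wY , bY , Y≢xᵢ , sim) →
        let ℓ≤M = ≤-pred ℓ<M+1 in
        pure (witness-in-support σ xs outside (≤-trans (pos 1 ≤-refl) (m≤m+n _ _)) (m+n≤o⇒m≤o∸n 1 M<e₁)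
          i Y wY (bY >>= λ b → pure (atMost-mono (+-monoʳ-≤ (g 1) (*-monoˡ-≤ sinc ℓ≤M)) b)) Y≢xᵢ
          (∼-mono (∸-monoʳ-≤ (e 1) ℓ≤M) sim))

      -- Eliminating the variable: the pairs after position 1 + M, with x_i
      -- replaced by Hω and σ without x_i, form an admissible sequence for
      -- (n, g') whenever σ had support size n + 1.
      module Shortened (n : ℕ) (len : length xs ≤ suc n) (terms : ∀ j → IsTerm (σ j))
                       (mono : Nondecreasing g) (el : Eliminable σ xs (g 1 + M * sinc) (e 1 ∸ M)) where
        open Eliminable el
        open Elimination H i H≢xᵢ

        off : ℕ
        off = 1 + M

        L' : ℕ
        L' = L ∸ off

        off+L' : off + L' ≡ L
        off+L' = m+[n∸m]≡n (<⇒≤ long)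

        En Fn Wn Wn' : ℕ → Tree
        En j  = subst (E (off + j)) xᵢ↦Hω
        Fn j  = subst (F (off + j)) xᵢ↦Hω
        Wn j  = subst (En j) (without σ)
        Wn' j = subst (Fn j) (without σ)

        in-range : ∀ j → j ≤ L' → off + j ≤ L
        in-range j j≤L' = ≤-trans (+-monoʳ-≤ off j≤L') (≤-reflexive off+L')

        -- The remaining levels lie strictly below e₁ − M, the level up to
        -- which the elimination preserves equivalence.
        level-below : ∀ j → 1 ≤ j → j ≤ L' → suc (e (off + j)) ≤ e 1 ∸ M
        level-below j 1≤j j≤L' = level-gap (e (off + j)) M j (e 1) 1≤j (level-bound (off + j) (s≤s z≤n) (in-range j j≤L'))

        levels' : ∀ j → 1 ≤ j → j ≤ L' → EqLIs (Wn j) (Wn' j) (fin (e (off + j)))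
        levels' j 1≤j j≤L' =
          let (W≈ , W'≈ , _) = pairs (off + j) (s≤s z≤n) (in-range j j≤L') in
          eql-transfer (level-below j 1≤j j≤L')
            (∼-respˡ (e 1 ∸ M) (≈-sym W≈) (transfer σ (e 1 ∸ M) matches (E (off + j))))
            (∼-respˡ (e 1 ∸ M) (≈-sym W'≈) (transfer σ (e 1 ∸ M) matches (F (off + j))))
            (levels (off + j) (s≤s z≤n) (in-range j j≤L'))

        decreasing' : ∀ j → 1 ≤ j → j < L' → e (off + suc j) < e (off + j)
        decreasing' j 1≤j j<L' = Eq.subst (λ t → e t < e (off + j)) (sym (+-suc off j))
          (decreasing (off + j) (s≤s z≤n) (≤-trans (≤-reflexive (sym (+-suc off j))) (in-range (suc j) j<L')))

        -- Each new term has at most PresSize(H) ≤ g(1) + M·SInc more subterms.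
        sizes' : ∀ j → 1 ≤ j → j ≤ L' → DoubleNegation (PairSizeLe (En j) (Fn j) (gPrime mel sinc g j))
        sizes' j _ j≤L' with proj₂ (proj₂ (pairs (off + j) (s≤s z≤n) (in-range j j≤L')))
        ... | (wE , wF , k₁ , k₂ , sE , sF , k≤) =
          H-size >>= λ bH →
          atMost⇒presSize (eliminated-atMost (presSize⇒atMost sE) bH) >>= λ (k₁' , k₁'≤ , sE') →
          atMost⇒presSize (eliminated-atMost (presSize⇒atMost sF) bH) >>= λ (k₂' , k₂'≤ , sF') →
          pure (eliminated-wf H-wf wE , eliminated-wf H-wf wF , k₁' , k₂' , sE' , sF' ,
                size-sum k₁ k₂ _ k₁' k₂' (g (off + j)) k₁'≤ k₂'≤ k≤)

        -- The new first level is at most e₁, so the bound on Rest persists.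
        below' : 1 ≤ L' → ∀ e' → EqLIs (Wn 1) (Wn' 1) (fin e') → BelowLEqL e' (Rest C B)
        below' 1≤L' e' level E' F' r =
          let (k , e₁<k , s) = below E' F' r in k , ≤-<-trans e'≤e₁ e₁<k , s
          where
          e'≤e₁ : e' ≤ e 1
          e'≤e₁ = ≤-trans (eql-max (levels' 1 ≤-refl 1≤L') (proj₁ level))
                    (≤-trans (n≤1+n _) (≤-trans (level-below 1 ≤-refl 1≤L') (m∸n≤m (e 1) M)))

        shortened : DoubleNegation (Admissible n (gPrime mel sinc g) L' Wn Wn')
        shortened = ¬¬-finite-choice _ L' sizes' >>= λ sizes → pure
          (((λ j → e (off + j)) , levels' , decreasing') ,
           (without σ , En , Fn , without-support σ xs n outside i∈xs len , without-terms σ terms ,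
            (λ j 1≤j j≤L' → ≈-refl , ≈-refl , sizes j 1≤j j≤L')) ,
           below')

    Previous : ℕ → Set
    Previous zero    = ⊤
    Previous (suc n) = Claim n

    -- A sequence of length at most 1 + M is fine; a longer one has an
    -- eliminable variable in the support of σ (so n > 0), and its shortened
    -- version of length L − (1 + M) is bounded by ℓ_{n-1,g'}.
    bound-step : ∀ n → Previous n → Claim n
    bound-step n previous g pos mono sb L W W' adm with L ≤? 1 + mel (g 1)
    ... | yes short = ≤-trans short (ell-≥ n g)
    bound-step n previous g pos mono sb L W W'
      ((e , levels , decreasing) , (σ , E , F , (xs , len , outside) , terms , pairs) , below) | no ¬short =
      decidable-stable (L ≤? ell mel sinc n g) (eliminable >>= after-elimination n previous len sb)
      where
      long : 1 + mel (g 1) < L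
      long = ≰⇒> ¬short
      open Long g pos (bound-g₁ n g sb) L W W' e levels decreasing σ E F xs outside pairs
                (below (≤-trans (s≤s z≤n) long) (e 1) (levels 1 ≤-refl (≤-trans (s≤s z≤n) long))) long

      after-elimination : ∀ n → Previous n → length xs ≤ n → SufficientSizeBound C mel sinc n g B →
                          Eliminable σ xs (g 1 + M * sinc) (e 1 ∸ M) → DoubleNegation (L ≤ ell mel sinc n g)
      after-elimination zero    _        len _ el = ⊥-elim (<⇒≱ (∈⇒nonempty (Eliminable.i∈xs el)) len)
      after-elimination (suc n) previous len (_ , _ , sb') el =
        shortened >>= λ adm' → pure (begin
          L                                        ≡⟨ sym off+L' ⟩
          off + L'                                 ≤⟨ +-monoʳ-≤ off (previous (gPrime mel sinc g)
                                                        (gPrime-positive g pos) (gPrime-nondecreasing g mono)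
                                                        sb' L' Wn Wn' adm') ⟩
          ell mel sinc (suc n) g                   ∎)
        where
        open Shortened n len terms mono el
        open ≤-Reasoning

    length-bound : ∀ n → Claim n
    length-bound zero    = bound-step zero tt
    length-bound (suc n) = bound-step (suc n) (length-bound n)

-- The closure of C under tree equality and the inequivalence of its pairs are
-- what make MEL^C well defined; here MEL^C is supplied as mel.
lemma3 : (G : Grammar) → let open FOG G in
    (C : PairSet) → RespectsTreeEq C →
    (∀ E F → C E F → ¬ (E ∼ F)) →
    (n : ℕ) (g : ℕ → ℕ) → Positive g → Nondecreasing g →
    (mel : ℕ → ℕ) → (∀ b → IsMEL C b (mel b)) →
    (sinc : ℕ) → IsSInc sinc →
    (B : ℕ) → SufficientSizeBound C mel sinc n g B →
    (L : ℕ) (W W' : ℕ → Tree) →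
    EqlevelDecreasing L W W' → NGSequence n g L W W' →
    (1 ≤ L → ∀ e₁ → EqLIs (W 1) (W' 1) (fin e₁) → BelowLEqL e₁ (Rest C B)) →
    L ≤ ell mel sinc n g
lemma3 G C _ _ n g pos mono mel mel-max sinc sinc-max B sb L W W' decreasing sequence below =
  length-bound n g pos mono sb L W W' (decreasing , sequence , below)
  where
  open Theory G
  open LengthBound C mel mel-max sinc sinc-max B
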